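{- Let $n\in\mathbb N_0$ and let $q$ be an odd positive integer. Then $$\sum_{i=0}^{n+q}\binom{n+q}i (n+q+i)(n+q+i-1)\cdots(n+i+1)\, E_{n+i}(0)=0,$$ where $(n+q+i)(n+q+i-1)\cdots(n+i+1)$ is the product of the $q$ consecutive integers from $n+i+1$ to $n+q+i$.
   Context: The Euler polynomials $E_n(a)$ are defined by $\frac{2e^{at}}{e^t+1}=\sum_{n=0}^\infty E_n(a)\frac{t^n}{n!}$; $\binom{N}{i}$ denotes the binomial coefficient. -}

module Defs where

open import Data.Nat using (ℕ; zero; suc)
import Data.Nat as ℕ
open import Data.Nat.Combinatorics using (_C_)
open import Data.Integer using (+_)
open import Data.Rational using (ℚ; 0ℚ; 1ℚ; ½; _+_; _*_; _-_; _/_)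
open import Data.Vec using (Vec; []; _∷_; _∷ʳ_; last; lookup)
open import Data.Fin using (Fin; toℕ)

ℕ→ℚ : ℕ → ℚ
ℕ→ℚ n = + n / 1

_^ℚ_ : ℚ → ℕ → ℚ
a ^ℚ zero = 1ℚ
a ^ℚ suc n = a * (a ^ℚ n)

Σℚ : ℕ → (ℕ → ℚ) → ℚ
Σℚ zero    f = 0ℚ
Σℚ (suc m) f = Σℚ m f + f m

Σvec : ∀ {m} → (ℕ → ℚ → ℚ) → Vec ℚ m → ℚ
Σvec {m} g v = Σfin m (λ i → g (toℕ i) (lookup v i))
  where
  Σfin : (k : ℕ) → (Fin k → ℚ) → ℚ
  Σfin zero    h = 0ℚ
  Σfin (suc k) h = h Fin.zero + Σfin k (λ i → h (Fin.suc i))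

-- Euler polynomials, defined by 2 e^{at}/(e^t+1) = Σ E_n(a) t^n/n!.
-- Multiplying by (e^t + 1) and comparing coefficients of t^n/n! gives
--   Σ_{k=0}^{n} C(n,k) E_k(a) + E_n(a) = 2 a^n,
-- i.e. E_n(a) = a^n - ½ Σ_{k=0}^{n-1} C(n,k) E_k(a).
-- eulerVec a n = [E_0(a), ..., E_n(a)].
eulerVec : ℚ → (n : ℕ) → Vec ℚ (suc n)
eulerVec a zero    = 1ℚ ∷ []
eulerVec a (suc n) = prev ∷ʳ (a ^ℚ suc n - ½ * Σvec (λ k e → ℕ→ℚ (suc n C k) * e) prev)
  where prev = eulerVec a n

E : ℕ → ℚ → ℚ
E n a = last (eulerVec a n)

-- Write T u c d = Σᵢ C(d,i) u(c+i). Both T u and (c, d) ↦ (-1)^(c+d) T u d c obey Pascal's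
-- rule in d, so binomial inversion reads T u* c d = (-1)^(c+d) T u d c for the alternating
-- transform u* c = (-1)^c T u 0 c. The recurrence T E 0 m + E m = 2δₘ₀ of the Euler numbers
-- E m = E_m(0) determines them and is preserved by u ↦ u*, hence E* = E, that is
-- T E c d = (-1)^(c+d) T E d c. Weighting by falling factorials, the sums
-- F c b q = Σᵢ C(b,i) (c+q+i)_q E(c+i) satisfy a recurrence in q whose two terms trade places
-- under c ↔ d, so F c (d+q) q = (-1)^(c+d+q) F d (c+q) q. For c = d = n and q odd the sum of
-- the theorem equals its own negative.

module Submission where

open import Defs
open import Data.Nat using (ℕ; _+_; _%_)
open import Data.Nat.Combinatorics using (_C_; _P_)
open import Data.Rational using (ℚ; 0ℚ; _*_)
open import Relation.Binary.PropositionalEquality using (_≡_)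

open import Algebra.Properties.CommutativeSemigroup using (x∙yz≈y∙xz)
open import Data.Bool using (true; false)
open import Relation.Nullary.Decidable using (dec⇒maybe)
open import Data.Nat using (zero; suc; _<_; _≤ᵇ_)
import Data.Nat as ℕ
import Data.Nat.Properties as ℕ
open import Data.Nat.Combinatorics using (nCn≡1; nC1≡n; nCk+nC[k+1]≡[n+1]C[k+1])
open import Data.Nat.Combinatorics.Base using (_P′_)
open import Data.Nat.Combinatorics.Specification using (k>n⇒nCk≡0)
open import Data.Nat.Coprimality using (1-coprimeTo) renaming (sym to coprime-sym)
open import Data.Nat.DivMod using (m≡m%n+[m/n]*n; [m+kn]%n≡m%n)
open import Data.Nat.Induction using (<-rec)
import Data.Nat.Tactic.RingSolver as ℕ-Solver
open import Data.Integer using (+_)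
import Data.Integer as ℤ
import Data.Integer.Properties as ℤ
open import Data.Rational using (mkℚ; 1ℚ; ½; -_; _-_; _/_)
import Data.Rational as ℚ
import Data.Rational.Properties as ℚ
open import Data.Vec using (Vec; []; _∷_; _∷ʳ_)
open import Data.Vec.Properties using (last-∷ʳ)
open import Relation.Binary.PropositionalEquality
  using (refl; sym; trans; cong; cong₂; module ≡-Reasoning)
open import Tactic.RingSolver using (solve-∀)
open import Tactic.RingSolver.Core.AlmostCommutativeRing
  using (AlmostCommutativeRing; fromCommutativeRing)

open ≡-Reasoning

ℚ-ring : AlmostCommutativeRing _ _
ℚ-ring = fromCommutativeRing ℚ.+-*-commutativeRing (λ x → dec⇒maybe (0ℚ ℚ.≟ x))

ℕ→ℚ-mkℚ : ∀ n → ℕ→ℚ n ≡ mkℚ (+ n) 0 (coprime-sym (1-coprimeTo n))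
ℕ→ℚ-mkℚ n = ℚ.normalize-coprime (coprime-sym (1-coprimeTo n))

ℕ→ℚ-+ : ∀ m n → ℕ→ℚ (m + n) ≡ ℕ→ℚ m ℚ.+ ℕ→ℚ n
ℕ→ℚ-+ m n rewrite ℕ→ℚ-mkℚ m | ℕ→ℚ-mkℚ n =
  cong (_/ 1) (trans (ℤ.pos-+ m n)
    (cong₂ ℤ._+_ (sym (ℤ.*-identityʳ (+ m))) (sym (ℤ.*-identityʳ (+ n)))))

ℕ→ℚ-* : ∀ m n → ℕ→ℚ (m ℕ.* n) ≡ ℕ→ℚ m * ℕ→ℚ n
ℕ→ℚ-* m n rewrite ℕ→ℚ-mkℚ m | ℕ→ℚ-mkℚ n = cong (_/ 1) (ℤ.pos-* m n)

+-self-injective : ∀ {x y} → x ℚ.+ x ≡ y ℚ.+ y → x ≡ y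
+-self-injective {x} {y} x+x≡y+y = begin
  x               ≡⟨ halve x ⟩
  ½ * (x ℚ.+ x)   ≡⟨ cong (½ *_) x+x≡y+y ⟩
  ½ * (y ℚ.+ y)   ≡⟨ sym (halve y) ⟩
  y               ∎
  where
  halve : ∀ z → z ≡ ½ * (z ℚ.+ z)
  halve = solve-∀ ℚ-ring

Σℚ-cong-< : ∀ m {f g : ℕ → ℚ} → (∀ i → i < m → f i ≡ g i) → Σℚ m f ≡ Σℚ m g
Σℚ-cong-< zero    f≡g = refl
Σℚ-cong-< (suc m) f≡g =
  cong₂ ℚ._+_ (Σℚ-cong-< m (λ i i<m → f≡g i (ℕ.m<n⇒m<1+n i<m))) (f≡g m (ℕ.n<1+n m))

Σℚ-cong : ∀ m {f g : ℕ → ℚ} → (∀ i → f i ≡ g i) → Σℚ m f ≡ Σℚ m g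
Σℚ-cong m f≡g = Σℚ-cong-< m (λ i _ → f≡g i)

Σℚ-+ : ∀ m (f g : ℕ → ℚ) → Σℚ m (λ i → f i ℚ.+ g i) ≡ Σℚ m f ℚ.+ Σℚ m g
Σℚ-+ zero    f g = refl
Σℚ-+ (suc m) f g rewrite Σℚ-+ m f g = interchange (Σℚ m f) (Σℚ m g) (f m) (g m)
  where
  interchange : ∀ a b c d → (a ℚ.+ b) ℚ.+ (c ℚ.+ d) ≡ (a ℚ.+ c) ℚ.+ (b ℚ.+ d)
  interchange = solve-∀ ℚ-ring

*-distribˡ-Σℚ : ∀ m c (f : ℕ → ℚ) → Σℚ m (λ i → c * f i) ≡ c * Σℚ m f
*-distribˡ-Σℚ zero    c f = sym (ℚ.*-zeroʳ c)
*-distribˡ-Σℚ (suc m) c f rewrite *-distribˡ-Σℚ m c f = sym (ℚ.*-distribˡ-+ c (Σℚ m f) (f m))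

Σℚ-suc-head : ∀ m (f : ℕ → ℚ) → Σℚ (suc m) f ≡ f 0 ℚ.+ Σℚ m (λ i → f (suc i))
Σℚ-suc-head zero    f = trans (ℚ.+-identityˡ (f 0)) (sym (ℚ.+-identityʳ (f 0)))
Σℚ-suc-head (suc m) f rewrite Σℚ-suc-head m f = ℚ.+-assoc (f 0) _ _

Σvec-∷ʳ : ∀ {m} (g : ℕ → ℚ → ℚ) (v : Vec ℚ m) x → Σvec g (v ∷ʳ x) ≡ Σvec g v ℚ.+ g m x
Σvec-∷ʳ g []      x = trans (ℚ.+-identityʳ (g 0 x)) (sym (ℚ.+-identityˡ (g 0 x)))
Σvec-∷ʳ g (y ∷ v) x =
  trans (cong (g 0 y ℚ.+_) (Σvec-∷ʳ (λ k → g (suc k)) v x)) (sym (ℚ.+-assoc (g 0 y) _ _))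

Σvec-eulerVec : ∀ a (g : ℕ → ℚ → ℚ) n → Σvec g (eulerVec a n) ≡ Σℚ (suc n) (λ k → g k (E k a))
Σvec-eulerVec a g zero    = trans (ℚ.+-identityʳ (g 0 1ℚ)) (sym (ℚ.+-identityˡ (g 0 1ℚ)))
Σvec-eulerVec a g (suc n) = begin
  Σvec g (eulerVec a n ∷ʳ Eₙ₊₁)          ≡⟨ Σvec-∷ʳ g (eulerVec a n) Eₙ₊₁ ⟩
  Σvec g (eulerVec a n) ℚ.+ g (suc n) Eₙ₊₁ ≡⟨ cong₂ ℚ._+_ (Σvec-eulerVec a g n)
                                               (cong (g (suc n)) (sym (last-∷ʳ Eₙ₊₁ (eulerVec a n)))) ⟩
  Σℚ (suc (suc n)) (λ k → g k (E k a))   ∎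
  where Eₙ₊₁ = a ^ℚ suc n - ½ * Σvec (λ k e → ℕ→ℚ (suc n C k) * e) (eulerVec a n)

E-suc : ∀ a n → E (suc n) a ≡ a ^ℚ suc n - ½ * Σℚ (suc n) (λ k → ℕ→ℚ (suc n C k) * E k a)
E-suc a n = trans (last-∷ʳ _ (eulerVec a n))
  (cong (λ s → a ^ℚ suc n - ½ * s) (Σvec-eulerVec a (λ k e → ℕ→ℚ (suc n C k) * e) n))

euler : ℕ → ℚ
euler m = E m 0ℚ

-- Binomial sums and binomial inversion

binomialSum : (ℕ → ℚ) → ℕ → ℕ → ℚ
binomialSum u c d = Σℚ (suc d) (λ i → ℕ→ℚ (d C i) * u (c + i))

twoAtZero : ℕ → ℚ
twoAtZero zero    = 1ℚ ℚ.+ 1ℚ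
twoAtZero (suc _) = 0ℚ

binomialSum-0+self : ∀ u m →
  binomialSum u 0 m ℚ.+ u m ≡ Σℚ m (λ i → ℕ→ℚ (m C i) * u i) ℚ.+ (u m ℚ.+ u m)
binomialSum-0+self u m = begin
  (S ℚ.+ ℕ→ℚ (m C m) * u m) ℚ.+ u m ≡⟨ cong (λ k → (S ℚ.+ ℕ→ℚ k * u m) ℚ.+ u m) (nCn≡1 m) ⟩
  (S ℚ.+ 1ℚ * u m) ℚ.+ u m          ≡⟨ regroup S (u m) ⟩
  S ℚ.+ (u m ℚ.+ u m)              ∎
  where
  S = Σℚ m (λ i → ℕ→ℚ (m C i) * u i)
  regroup : ∀ s x → (s ℚ.+ 1ℚ * x) ℚ.+ x ≡ s ℚ.+ (x ℚ.+ x)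
  regroup = solve-∀ ℚ-ring

euler-recurrence : ∀ m → binomialSum euler 0 m ℚ.+ euler m ≡ twoAtZero m
euler-recurrence zero    = refl
euler-recurrence (suc n) = begin
  binomialSum euler 0 (suc n) ℚ.+ euler (suc n)      ≡⟨ binomialSum-0+self euler (suc n) ⟩
  S ℚ.+ (euler (suc n) ℚ.+ euler (suc n))            ≡⟨ cong (λ e → S ℚ.+ (e ℚ.+ e)) (E-suc 0ℚ n) ⟩
  S ℚ.+ ((0ℚ * p - ½ * S) ℚ.+ (0ℚ * p - ½ * S))      ≡⟨ vanish S p ⟩
  0ℚ                                                ∎
  where
  S = Σℚ (suc n) (λ k → ℕ→ℚ (suc n C k) * euler k)
  p = 0ℚ ^ℚ n
  vanish : ∀ s p → s ℚ.+ ((0ℚ * p - ½ * s) ℚ.+ (0ℚ * p - ½ * s)) ≡ 0ℚ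
  vanish = solve-∀ ℚ-ring

binomialSum-0+self-injective : (u v : ℕ → ℚ) →
  (∀ m → binomialSum u 0 m ℚ.+ u m ≡ binomialSum v 0 m ℚ.+ v m) → ∀ m → u m ≡ v m
binomialSum-0+self-injective u v u≈v = <-rec (λ m → u m ≡ v m) step
  where
  step : ∀ m → (∀ {i} → i < m → u i ≡ v i) → u m ≡ v m
  step m ih = +-self-injective (begin
    u m ℚ.+ u m                                     ≡⟨ unshift S (u m ℚ.+ u m) ⟩
    S ℚ.+ (u m ℚ.+ u m) - S                         ≡⟨ cong (_- S) (sym (binomialSum-0+self u m)) ⟩
    binomialSum u 0 m ℚ.+ u m - S                   ≡⟨ cong (_- S) (u≈v m) ⟩
    binomialSum v 0 m ℚ.+ v m - S                   ≡⟨ cong (_- S) (binomialSum-0+self v m) ⟩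
    Σℚ m (λ i → ℕ→ℚ (m C i) * v i) ℚ.+ (v m ℚ.+ v m) - S
      ≡⟨ cong (λ s → s ℚ.+ (v m ℚ.+ v m) - S)
           (Σℚ-cong-< m (λ i i<m → cong (ℕ→ℚ (m C i) *_) (sym (ih i<m)))) ⟩
    S ℚ.+ (v m ℚ.+ v m) - S                         ≡⟨ sym (unshift S (v m ℚ.+ v m)) ⟩
    v m ℚ.+ v m                                     ∎)
    where
    S = Σℚ m (λ i → ℕ→ℚ (m C i) * u i)
    unshift : ∀ s x → x ≡ s ℚ.+ x - s
    unshift = solve-∀ ℚ-ring

binomialSum-cong : ∀ {u v} → (∀ i → u i ≡ v i) → ∀ c d → binomialSum u c d ≡ binomialSum v c d
binomialSum-cong u≡v c d = Σℚ-cong (suc d) (λ i → cong (ℕ→ℚ (d C i) *_) (u≡v (c + i)))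

binomialSum-0 : ∀ u c → binomialSum u c 0 ≡ u c
binomialSum-0 u c = trans (drop-unit (u (c + 0))) (cong u (ℕ.+-identityʳ c))
  where
  drop-unit : ∀ x → 0ℚ ℚ.+ 1ℚ * x ≡ x
  drop-unit = solve-∀ ℚ-ring

Pascal : (ℕ → ℕ → ℚ) → Set
Pascal X = ∀ c d → X c (suc d) ≡ X c d ℚ.+ X (suc c) d

module _ {X Y : ℕ → ℕ → ℚ} (pX : Pascal X) (pY : Pascal Y) (X≡Y : ∀ c → X c 0 ≡ Y c 0) where

  Pascal-unique : ∀ d c → X c d ≡ Y c d
  Pascal-unique zero    c = X≡Y c
  Pascal-unique (suc d) c =
    trans (pX c d) (trans (cong₂ ℚ._+_ (Pascal-unique d c) (Pascal-unique d (suc c))) (sym (pY c d)))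

binomialSum-Pascal : ∀ u → Pascal (binomialSum u)
binomialSum-Pascal u c d = begin
  binomialSum u c (suc d)
    ≡⟨ Σℚ-suc-head (suc d) _ ⟩
  h ℚ.+ Σℚ (suc d) (λ i → ℕ→ℚ (suc d C suc i) * u (c + suc i))
    ≡⟨ cong (h ℚ.+_) (trans (Σℚ-cong (suc d) split) (Σℚ-+ (suc d) _ _)) ⟩
  h ℚ.+ (binomialSum u (suc c) d ℚ.+ (tail ℚ.+ ℕ→ℚ (d C suc d) * u (c + suc d)))
    ≡⟨ cong (λ k → h ℚ.+ (binomialSum u (suc c) d ℚ.+ (tail ℚ.+ ℕ→ℚ k * u (c + suc d))))
         (k>n⇒nCk≡0 (ℕ.n<1+n d)) ⟩
  h ℚ.+ (binomialSum u (suc c) d ℚ.+ (tail ℚ.+ 0ℚ * u (c + suc d)))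
    ≡⟨ regroup h (binomialSum u (suc c) d) tail (u (c + suc d)) ⟩
  (h ℚ.+ tail) ℚ.+ binomialSum u (suc c) d
    ≡⟨ cong (ℚ._+ binomialSum u (suc c) d) (sym (Σℚ-suc-head d _)) ⟩
  binomialSum u c d ℚ.+ binomialSum u (suc c) d ∎
  where
  h    = ℕ→ℚ 1 * u (c + 0)
  tail = Σℚ d (λ i → ℕ→ℚ (d C suc i) * u (c + suc i))
  split : ∀ i → ℕ→ℚ (suc d C suc i) * u (c + suc i)
              ≡ ℕ→ℚ (d C i) * u (suc c + i) ℚ.+ ℕ→ℚ (d C suc i) * u (c + suc i)
  split i = begin
    ℕ→ℚ (suc d C suc i) * x              ≡⟨ cong (λ k → ℕ→ℚ k * x) (sym (nCk+nC[k+1]≡[n+1]C[k+1] d i)) ⟩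
    ℕ→ℚ (d C i + d C suc i) * x          ≡⟨ cong (_* x) (ℕ→ℚ-+ (d C i) (d C suc i)) ⟩
    (ℕ→ℚ (d C i) ℚ.+ ℕ→ℚ (d C suc i)) * x ≡⟨ ℚ.*-distribʳ-+ x (ℕ→ℚ (d C i)) (ℕ→ℚ (d C suc i)) ⟩
    ℕ→ℚ (d C i) * x ℚ.+ ℕ→ℚ (d C suc i) * x
      ≡⟨ cong (λ j → ℕ→ℚ (d C i) * u j ℚ.+ ℕ→ℚ (d C suc i) * x) (ℕ.+-suc c i) ⟩
    ℕ→ℚ (d C i) * u (suc c + i) ℚ.+ ℕ→ℚ (d C suc i) * x ∎
    where x = u (c + suc i)
  regroup : ∀ h b t x → h ℚ.+ (b ℚ.+ (t ℚ.+ 0ℚ * x)) ≡ (h ℚ.+ t) ℚ.+ b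
  regroup = solve-∀ ℚ-ring

alternatingTransform : (ℕ → ℚ) → ℕ → ℚ
alternatingTransform u c = (- 1ℚ) ^ℚ c * binomialSum u 0 c

binomialSum-alternatingTransform : ∀ u c d →
  binomialSum (alternatingTransform u) c d ≡ (- 1ℚ) ^ℚ (c + d) * binomialSum u d c
binomialSum-alternatingTransform u c d =
  Pascal-unique {binomialSum (alternatingTransform u)} {dual}
    (binomialSum-Pascal (alternatingTransform u)) dual-Pascal at-0 d c
  where
  dual : ℕ → ℕ → ℚ
  dual c d = (- 1ℚ) ^ℚ (c + d) * binomialSum u d c
  dual-Pascal : Pascal dual
  dual-Pascal c d = begin
    (- 1ℚ) ^ℚ (c + suc d) * T′
      ≡⟨ cong (λ k → (- 1ℚ) ^ℚ k * T′) (ℕ.+-suc c d) ⟩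
    (- 1ℚ) * s * T′
      ≡⟨ flip-sign s T T′ ⟩
    s * T ℚ.+ (- 1ℚ) * s * (T ℚ.+ T′)
      ≡⟨ cong (λ z → s * T ℚ.+ (- 1ℚ) * s * z) (sym (binomialSum-Pascal u d c)) ⟩
    dual c d ℚ.+ dual (suc c) d ∎
    where
    s  = (- 1ℚ) ^ℚ (c + d)
    T  = binomialSum u d c
    T′ = binomialSum u (suc d) c
    flip-sign : ∀ s x y → (- 1ℚ) * s * y ≡ s * x ℚ.+ (- 1ℚ) * s * (x ℚ.+ y)
    flip-sign = solve-∀ ℚ-ring
  at-0 : ∀ c → binomialSum (alternatingTransform u) c 0 ≡ dual c 0
  at-0 c = trans (binomialSum-0 (alternatingTransform u) c)
                 (cong (λ k → (- 1ℚ) ^ℚ k * binomialSum u 0 c) (sym (ℕ.+-identityʳ c)))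

-1^-twoAtZero : ∀ m → (- 1ℚ) ^ℚ m * twoAtZero m ≡ twoAtZero m
-1^-twoAtZero zero    = ℚ.*-identityˡ (twoAtZero 0)
-1^-twoAtZero (suc m) = ℚ.*-zeroʳ ((- 1ℚ) ^ℚ suc m)

euler-alternatingTransform : ∀ m → alternatingTransform euler m ≡ euler m
euler-alternatingTransform = binomialSum-0+self-injective (alternatingTransform euler) euler
  (λ m → trans (recurrence m) (sym (euler-recurrence m)))
  where
  recurrence : ∀ m → binomialSum (alternatingTransform euler) 0 m ℚ.+ alternatingTransform euler m
                     ≡ twoAtZero m
  recurrence m = begin
    binomialSum (alternatingTransform euler) 0 m ℚ.+ s * T
      ≡⟨ cong (ℚ._+ s * T) (binomialSum-alternatingTransform euler 0 m) ⟩
    s * binomialSum euler m 0 ℚ.+ s * T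
      ≡⟨ cong (λ e → s * e ℚ.+ s * T) (binomialSum-0 euler m) ⟩
    s * euler m ℚ.+ s * T
      ≡⟨ sym (ℚ.*-distribˡ-+ s (euler m) T) ⟩
    s * (euler m ℚ.+ T)
      ≡⟨ cong (s *_) (trans (ℚ.+-comm (euler m) T) (euler-recurrence m)) ⟩
    s * twoAtZero m
      ≡⟨ -1^-twoAtZero m ⟩
    twoAtZero m ∎
    where
    s = (- 1ℚ) ^ℚ m
    T = binomialSum euler 0 m

BinomialSelfDual : (ℕ → ℚ) → Set
BinomialSelfDual u = ∀ c d → binomialSum u c d ≡ (- 1ℚ) ^ℚ (c + d) * binomialSum u d c

euler-binomialSelfDual : BinomialSelfDual euler
euler-binomialSelfDual c d =
  trans (sym (binomialSum-cong euler-alternatingTransform c d))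
        (binomialSum-alternatingTransform euler c d)

-- Falling factorials

[n+1]P′[k+1]≡[n+1]*nP′k : ∀ n k → suc n P′ suc k ≡ suc n ℕ.* (n P′ k)
[n+1]P′[k+1]≡[n+1]*nP′k n zero    = refl
[n+1]P′[k+1]≡[n+1]*nP′k n (suc k) rewrite [n+1]P′[k+1]≡[n+1]*nP′k n k =
  x∙yz≈y∙xz ℕ.*-commutativeSemigroup (n ℕ.∸ k) (suc n) (n P′ k)

k<ᵇ1+n≡k≤ᵇn : ∀ k n → (k ℕ.<ᵇ suc n) ≡ (k ≤ᵇ n)
k<ᵇ1+n≡k≤ᵇn zero    n = refl
k<ᵇ1+n≡k≤ᵇn (suc k) n = refl

[n+1]P[k+1]≡[n+1]*nPk : ∀ n k → suc n P suc k ≡ suc n ℕ.* (n P k)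
[n+1]P[k+1]≡[n+1]*nPk n k rewrite k<ᵇ1+n≡k≤ᵇn k n with k ≤ᵇ n
... | true  = [n+1]P′[k+1]≡[n+1]*nP′k n k
... | false = sym (ℕ.*-zeroʳ (suc n))

[k+1]*[n+1]C[k+1]≡[n+1]*nCk : ∀ n k → suc k ℕ.* (suc n C suc k) ≡ suc n ℕ.* (n C k)
[k+1]*[n+1]C[k+1]≡[n+1]*nCk zero    zero    = refl
[k+1]*[n+1]C[k+1]≡[n+1]*nCk zero    (suc k) = ℕ.*-zeroʳ (suc (suc k))
[k+1]*[n+1]C[k+1]≡[n+1]*nCk (suc n) zero    =
  trans (ℕ.+-identityʳ _) (trans (nC1≡n (suc (suc n))) (sym (ℕ.*-identityʳ (suc (suc n)))))
[k+1]*[n+1]C[k+1]≡[n+1]*nCk (suc n) (suc k) = begin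
  suc (suc k) ℕ.* (suc (suc n) C suc (suc k))
    ≡⟨ cong (suc (suc k) ℕ.*_) (sym (nCk+nC[k+1]≡[n+1]C[k+1] (suc n) (suc k))) ⟩
  suc (suc k) ℕ.* (X + Y)
    ≡⟨ expand k X Y ⟩
  X + suc k ℕ.* X + suc (suc k) ℕ.* Y
    ≡⟨ cong₂ (λ a b → X + a + b) ([k+1]*[n+1]C[k+1]≡[n+1]*nCk n k) ([k+1]*[n+1]C[k+1]≡[n+1]*nCk n (suc k)) ⟩
  X + suc n ℕ.* (n C k) + suc n ℕ.* (n C suc k)
    ≡⟨ ℕ.+-assoc X _ _ ⟩
  X + (suc n ℕ.* (n C k) + suc n ℕ.* (n C suc k))
    ≡⟨ cong (λ z → X + z) (sym (ℕ.*-distribˡ-+ (suc n) (n C k) (n C suc k))) ⟩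
  X + suc n ℕ.* (n C k + n C suc k)
    ≡⟨ cong (λ z → X + suc n ℕ.* z) (nCk+nC[k+1]≡[n+1]C[k+1] n k) ⟩
  suc (suc n) ℕ.* X ∎
  where
  X = suc n C suc k
  Y = suc n C suc (suc k)
  expand : ∀ k X Y → suc (suc k) ℕ.* (X + Y) ≡ X + suc k ℕ.* X + suc (suc k) ℕ.* Y
  expand = ℕ-Solver.solve-∀

fallingTerm : (ℕ → ℚ) → ℕ → ℕ → ℕ → ℕ → ℚ
fallingTerm u c b q i = ℕ→ℚ (b C i) * ℕ→ℚ ((c + q + i) P q) * u (c + i)

fallingSum : (ℕ → ℚ) → ℕ → ℕ → ℕ → ℚ
fallingSum u c b q = Σℚ (suc b) (fallingTerm u c b q)

fallingSum-0 : ∀ u c b → fallingSum u c b 0 ≡ binomialSum u c b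
fallingSum-0 u c b = Σℚ-cong (suc b) (λ i → cong (_* u (c + i)) (ℚ.*-identityʳ (ℕ→ℚ (b C i))))

index-weighted-fallingSum : ∀ u c b q →
  Σℚ (suc (suc b)) (λ i → ℕ→ℚ i * fallingTerm u c (suc b) q i)
  ≡ ℕ→ℚ (suc b) * fallingSum u (suc c) b q
index-weighted-fallingSum u c b q = begin
  Σℚ (suc (suc b)) (λ i → ℕ→ℚ i * fallingTerm u c (suc b) q i)
    ≡⟨ Σℚ-suc-head (suc b) (λ i → ℕ→ℚ i * fallingTerm u c (suc b) q i) ⟩
  0ℚ * fallingTerm u c (suc b) q 0 ℚ.+ rest
    ≡⟨ cong (ℚ._+ rest) (ℚ.*-zeroˡ (fallingTerm u c (suc b) q 0)) ⟩
  0ℚ ℚ.+ rest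
    ≡⟨ ℚ.+-identityˡ rest ⟩
  rest
    ≡⟨ Σℚ-cong (suc b) absorb ⟩
  Σℚ (suc b) (λ j → ℕ→ℚ (suc b) * fallingTerm u (suc c) b q j)
    ≡⟨ *-distribˡ-Σℚ (suc b) (ℕ→ℚ (suc b)) (fallingTerm u (suc c) b q) ⟩
  ℕ→ℚ (suc b) * fallingSum u (suc c) b q ∎
  where
  rest = Σℚ (suc b) (λ j → ℕ→ℚ (suc j) * fallingTerm u c (suc b) q (suc j))
  reassoc : ∀ a k p x → a * (k * p * x) ≡ a * k * (p * x)
  reassoc = solve-∀ ℚ-ring
  absorb : ∀ j → ℕ→ℚ (suc j) * fallingTerm u c (suc b) q (suc j)
                 ≡ ℕ→ℚ (suc b) * fallingTerm u (suc c) b q j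
  absorb j = begin
    ℕ→ℚ (suc j) * fallingTerm u c (suc b) q (suc j)
      ≡⟨ reassoc (ℕ→ℚ (suc j)) (ℕ→ℚ (suc b C suc j)) (ℕ→ℚ ((c + q + suc j) P q)) (u (c + suc j)) ⟩
    ℕ→ℚ (suc j) * ℕ→ℚ (suc b C suc j) * (ℕ→ℚ ((c + q + suc j) P q) * u (c + suc j))
      ≡⟨ cong (_* (ℕ→ℚ ((c + q + suc j) P q) * u (c + suc j)))
           (trans (sym (ℕ→ℚ-* (suc j) (suc b C suc j))) (trans (cong ℕ→ℚ ([k+1]*[n+1]C[k+1]≡[n+1]*nCk b j)) (ℕ→ℚ-* (suc b) (b C j)))) ⟩
    ℕ→ℚ (suc b) * ℕ→ℚ (b C j) * (ℕ→ℚ ((c + q + suc j) P q) * u (c + suc j))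
      ≡⟨ cong₂ (λ k l → ℕ→ℚ (suc b) * ℕ→ℚ (b C j) * (ℕ→ℚ (k P q) * u l))
           (ℕ.+-suc (c + q) j) (ℕ.+-suc c j) ⟩
    ℕ→ℚ (suc b) * ℕ→ℚ (b C j) * (ℕ→ℚ ((suc c + q + j) P q) * u (suc c + j))
      ≡⟨ sym (reassoc (ℕ→ℚ (suc b)) (ℕ→ℚ (b C j)) (ℕ→ℚ ((suc c + q + j) P q)) (u (suc c + j))) ⟩
    ℕ→ℚ (suc b) * fallingTerm u (suc c) b q j ∎

-- (N + 1 + i)P(q + 1) = (N + 1 + i) · (N + i)P q splits each term in two; the part weighted
-- by i is absorbed by the binomial coefficient.
fallingSum-suc : ∀ u c b q →
  fallingSum u c (suc b) (suc q)
  ≡ ℕ→ℚ (suc (c + q)) * fallingSum u c (suc b) q ℚ.+ ℕ→ℚ (suc b) * fallingSum u (suc c) b q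
fallingSum-suc u c b q = begin
  fallingSum u c (suc b) (suc q)
    ≡⟨ Σℚ-cong (suc (suc b)) split ⟩
  Σℚ (suc (suc b)) (λ i → a * t i ℚ.+ ℕ→ℚ i * t i)
    ≡⟨ Σℚ-+ (suc (suc b)) _ _ ⟩
  Σℚ (suc (suc b)) (λ i → a * t i) ℚ.+ Σℚ (suc (suc b)) (λ i → ℕ→ℚ i * t i)
    ≡⟨ cong₂ ℚ._+_ (*-distribˡ-Σℚ (suc (suc b)) a t) (index-weighted-fallingSum u c b q) ⟩
  a * fallingSum u c (suc b) q ℚ.+ ℕ→ℚ (suc b) * fallingSum u (suc c) b q ∎
  where
  a = ℕ→ℚ (suc (c + q))
  t = fallingTerm u c (suc b) q
  distribute : ∀ k a i p x → k * ((a ℚ.+ i) * p) * x ≡ a * (k * p * x) ℚ.+ i * (k * p * x)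
  distribute = solve-∀ ℚ-ring
  split : ∀ i → fallingTerm u c (suc b) (suc q) i ≡ a * t i ℚ.+ ℕ→ℚ i * t i
  split i = begin
    ℕ→ℚ (suc b C i) * ℕ→ℚ ((c + suc q + i) P suc q) * u (c + i)
      ≡⟨ cong (λ k → ℕ→ℚ (suc b C i) * ℕ→ℚ k * u (c + i))
           (trans (cong (λ k → (k + i) P suc q) (ℕ.+-suc c q)) ([n+1]P[k+1]≡[n+1]*nPk (c + q + i) q)) ⟩
    ℕ→ℚ (suc b C i) * ℕ→ℚ ((suc (c + q) + i) ℕ.* p) * u (c + i)
      ≡⟨ cong (λ r → ℕ→ℚ (suc b C i) * r * u (c + i))
           (trans (ℕ→ℚ-* (suc (c + q) + i) p) (cong (_* ℕ→ℚ p) (ℕ→ℚ-+ (suc (c + q)) i))) ⟩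
    ℕ→ℚ (suc b C i) * ((a ℚ.+ ℕ→ℚ i) * ℕ→ℚ p) * u (c + i)
      ≡⟨ distribute (ℕ→ℚ (suc b C i)) a (ℕ→ℚ i) (ℕ→ℚ p) (u (c + i)) ⟩
    a * t i ℚ.+ ℕ→ℚ i * t i ∎
    where p = (c + q + i) P q

module _ (u : ℕ → ℚ) (selfDual : BinomialSelfDual u) where

  fallingSum-selfDual : ∀ q c d →
    fallingSum u c (d + q) q ≡ (- 1ℚ) ^ℚ (c + d + q) * fallingSum u d (c + q) q
  fallingSum-selfDual zero c d = begin
    fallingSum u c (d + 0) 0
      ≡⟨ cong (λ k → fallingSum u c k 0) (ℕ.+-identityʳ d) ⟩
    fallingSum u c d 0
      ≡⟨ fallingSum-0 u c d ⟩
    binomialSum u c d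
      ≡⟨ selfDual c d ⟩
    (- 1ℚ) ^ℚ (c + d) * binomialSum u d c
      ≡⟨ cong₂ (λ k s → (- 1ℚ) ^ℚ k * s) (sym (ℕ.+-identityʳ (c + d)))
           (sym (trans (cong (λ k → fallingSum u d k 0) (ℕ.+-identityʳ c)) (fallingSum-0 u d c))) ⟩
    (- 1ℚ) ^ℚ (c + d + 0) * fallingSum u d (c + 0) 0 ∎
  fallingSum-selfDual (suc q) c d = begin
    fallingSum u c (d + suc q) (suc q)
      ≡⟨ cong (λ k → fallingSum u c k (suc q)) (ℕ.+-suc d q) ⟩
    fallingSum u c (suc (d + q)) (suc q)
      ≡⟨ fallingSum-suc u c (d + q) q ⟩
    a * fallingSum u c (suc d + q) q ℚ.+ a′ * fallingSum u (suc c) (d + q) q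
      ≡⟨ cong₂ (λ x y → a * x ℚ.+ a′ * y)
           (trans (fallingSum-selfDual q c (suc d))
                  (cong (λ k → (- 1ℚ) ^ℚ (k + q) * fallingSum u (suc d) (c + q) q) (ℕ.+-suc c d)))
           (fallingSum-selfDual q (suc c) d) ⟩
    a * (s * fallingSum u (suc d) (c + q) q) ℚ.+ a′ * (s * fallingSum u d (suc c + q) q)
      ≡⟨ factor a s (fallingSum u (suc d) (c + q) q) a′ (fallingSum u d (suc c + q) q) ⟩
    s * (a′ * fallingSum u d (suc (c + q)) q ℚ.+ a * fallingSum u (suc d) (c + q) q)
      ≡⟨ cong (s *_) (sym (fallingSum-suc u d (c + q) q)) ⟩
    s * fallingSum u d (suc (c + q)) (suc q)
      ≡⟨ cong₂ (λ k l → (- 1ℚ) ^ℚ k * fallingSum u d l (suc q)) (sym (ℕ.+-suc (c + d) q)) (sym (ℕ.+-suc c q)) ⟩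
    (- 1ℚ) ^ℚ (c + d + suc q) * fallingSum u d (c + suc q) (suc q) ∎
    where
    a  = ℕ→ℚ (suc (c + q))
    a′ = ℕ→ℚ (suc (d + q))
    s  = (- 1ℚ) ^ℚ suc (c + d + q)
    factor : ∀ a s x a′ y → a * (s * x) ℚ.+ a′ * (s * y) ≡ s * (a′ * y ℚ.+ a * x)
    factor = solve-∀ ℚ-ring

-1^-even : ∀ k → (- 1ℚ) ^ℚ (k ℕ.* 2) ≡ 1ℚ
-1^-even zero    = refl
-1^-even (suc k) = trans (square (((- 1ℚ) ^ℚ (k ℕ.* 2)))) (-1^-even k)
  where
  square : ∀ x → (- 1ℚ) * ((- 1ℚ) * x) ≡ x
  square = solve-∀ ℚ-ring

-1^-odd : ∀ m → m % 2 ≡ 1 → (- 1ℚ) ^ℚ m ≡ - 1ℚ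
-1^-odd m m-odd = begin
  (- 1ℚ) ^ℚ m                           ≡⟨ cong ((- 1ℚ) ^ℚ_) (m≡m%n+[m/n]*n m 2) ⟩
  (- 1ℚ) ^ℚ (m % 2 + m ℕ./ 2 ℕ.* 2)     ≡⟨ cong (λ r → (- 1ℚ) ^ℚ (r + m ℕ./ 2 ℕ.* 2)) m-odd ⟩
  (- 1ℚ) * (- 1ℚ) ^ℚ (m ℕ./ 2 ℕ.* 2)    ≡⟨ cong ((- 1ℚ) *_) (-1^-even (m ℕ./ 2)) ⟩
  (- 1ℚ) * 1ℚ                           ≡⟨ ℚ.*-identityʳ (- 1ℚ) ⟩
  - 1ℚ                                  ∎

x≡-x⇒x≡0 : ∀ {x} → x ≡ (- 1ℚ) * x → x ≡ 0ℚ
x≡-x⇒x≡0 {x} x≡-x = +-self-injective (trans (cong (x ℚ.+_) x≡-x) (cancel x))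
  where
  cancel : ∀ x → x ℚ.+ (- 1ℚ) * x ≡ 0ℚ ℚ.+ 0ℚ
  cancel = solve-∀ ℚ-ring

corollary1p3 : (n q : ℕ) → q % 2 ≡ 1 →
    Σℚ (n + q + 1) (λ i → ℕ→ℚ ((n + q) C i) * ℕ→ℚ ((n + q + i) P q) * E (n + i) 0ℚ) ≡ 0ℚ
corollary1p3 n q q-odd = trans (cong (λ k → Σℚ k (fallingTerm euler n (n + q) q)) (ℕ.+-comm (n + q) 1))
  (x≡-x⇒x≡0 (begin
    fallingSum euler n (n + q) q
      ≡⟨ fallingSum-selfDual euler euler-binomialSelfDual q n n ⟩
    (- 1ℚ) ^ℚ (n + n + q) * fallingSum euler n (n + q) q
      ≡⟨ cong (_* fallingSum euler n (n + q) q) (-1^-odd (n + n + q) n+n+q-odd) ⟩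
    (- 1ℚ) * fallingSum euler n (n + q) q ∎))
  where
  n+n+q-odd : (n + n + q) % 2 ≡ 1
  n+n+q-odd = begin
    (n + n + q) % 2      ≡⟨ cong (_% 2) (rearrange n q) ⟩
    (q + n ℕ.* 2) % 2    ≡⟨ [m+kn]%n≡m%n q n 2 ⟩
    q % 2                ≡⟨ q-odd ⟩
    1                    ∎
    where
    rearrange : ∀ n q → n + n + q ≡ q + n ℕ.* 2
    rearrange = ℕ-Solver.solve-∀
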